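{- Let $p\ge 7$ be a prime. Then (i) $\displaystyle\sum_{k=1}^{p-1}\frac{H_{k-1}}{k^3}\equiv \sum_{k=1}^{p-1}\frac{H_k}{k^3}\equiv 0\pmod{p}$; (ii) $\displaystyle\sum_{k=1}^{p-1}\frac{H_k^3}{k}\equiv\frac{3}{2}\sum_{k=1}^{p-1}\frac{H_k^2}{k^2}\pmod{p}$; (iii) $\displaystyle\sum_{k=1}^{p-1}\frac{H_{k-1,3}}{k}\equiv \sum_{k=1}^{p-1}\frac{H_{k,3}}{k}\equiv 0\pmod{p}$; (iv) $\displaystyle\sum_{k=1}^{p-1}\frac{H_k}{k^2}\equiv \sum_{k=1}^{p-1}\frac{H_k^2}{k}\pmod{p^2}$.
   Context: For integers $n\ge0$, $m\ge1$, $H_{n,m}=\sum_{k=1}^{n}\frac{1}{k^m}$ and $H_n=H_{n,1}$, with $H_{0,m}=H_0=0$. Congruences modulo powers of $p$ are taken in the ring of rational numbers with denominators not divisible by $p$. -}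

module Defs where

open import Data.Nat as ℕ using (ℕ; zero; suc; _^_)
open import Data.Nat.Divisibility as ℕD using ()
open import Data.Integer as ℤ using (ℤ; +_)
open import Data.Rational as ℚ using (ℚ; _+_; _*_; _-_; 0ℚ; 1ℚ; ↥_; ↧ₙ_)
open import Data.Product using (_×_)
open import Relation.Nullary using (¬_)

infixr 8 _^ℚ_
_^ℚ_ : ℚ → ℕ → ℚ
q ^ℚ zero    = 1ℚ
q ^ℚ (suc m) = q * (q ^ℚ m)

-- 1 / k^m for k ≥ 1 (the value at k = 0 is never used)
invPow : ℕ → ℕ → ℚ
invPow zero    m = 0ℚ
invPow (suc i) m = (ℤ.+ 1 ℚ./ suc i) ^ℚ m

sumTo : ℕ → (ℕ → ℚ) → ℚ
sumTo zero    f = 0ℚ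
sumTo (suc n) f = sumTo n f + f (suc n)

H : ℕ → ℕ → ℚ
H n m = sumTo n (λ k → invPow k m)

H₁ : ℕ → ℚ
H₁ n = H n 1

-- x ≡ y (mod p^e) in Z_(p): writing x - y = a/b in lowest terms,
-- p does not divide b and p^e divides a.
_≡_mod_^_ : ℚ → ℚ → ℕ → ℕ → Set
x ≡ y mod p ^ e =
  (¬ (p ℕD.∣ ↧ₙ (x - y))) × ((p ^ e) ℕD.∣ ℤ.∣ ↥ (x - y) ∣)

{-# OPTIONS --safe #-}
-- Pairing k with p − k gives 1/k + 1/(p − k) = p/(k(p − k)), so 1/(p − k) ≡ −1/k (mod p).
-- Summed over k this yields H_{p−1} ≡ 0 (mod p) and, after expanding a³ + b³ around a + b,
-- H_{p−1,3} ≡ 0 (mod p²). Splitting H_{p−1,4} into halves and into even and odd terms shows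
-- 2H_{(p−1)/2,4} ≡ 2⁻³H_{(p−1)/2,4}, hence H_{p−1,4} ≡ 0 (mod p) since p ∤ 30.
-- For odd m with H_{p−1,m} ≡ 0 the reflection gives H_{p−1−k,m} ≡ H_{k,m}, so reversing the
-- summation turns Σ H_{k−1,m}/k^(4−m) into −Σ H_{k,m}/k^(4−m), while the two sums differ by
-- H_{p−1,4}; this is (i) and (iii). Telescoping H_k³ and H_k⁴ over k reduces (iv) and (ii)
-- to (i) and the three vanishing harmonic sums.
module Submission where

open import Data.Nat as ℕ using (ℕ; zero; suc; _≥_; _∸_; _≤_; _<_; s≤s; z≤n)
import Data.Nat.Properties as ℕP
open import Data.Nat.Divisibility as ℕD using (_∣_; divides)
open import Data.Nat.Primality
  using (Prime; euclidsLemma; prime⇒nonTrivial; prime⇒nonZero; prime⇒irreducible)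
open import Data.Nat.Coprimality using (Coprime; 1-coprimeTo)
import Data.Nat.Coprimality as Cop
import Data.Nat.Tactic.RingSolver as ℕSolver
open import Data.Integer as ℤ using (ℤ; +_)
import Data.Integer.Properties as ℤP
open import Data.Rational as ℚ using (ℚ; mkℚ; _+_; _*_; _-_; -_; 0ℚ; 1ℚ; _/_; ↥_; ↧ₙ_)
import Data.Rational.Properties as ℚP
import Data.Rational.Unnormalised as ℚᵘ
import Data.Rational.Unnormalised.Properties as ℚᵘP
open import Data.Rational.Solver using (module +-*-Solver)
open import Data.Product using (_×_; _,_; Σ; proj₁; proj₂)
open import Data.Sum using (_⊎_; inj₁; inj₂)
open import Data.Empty using (⊥-elim)
open import Relation.Nullary using (¬_)
open import Relation.Nullary.Decidable using (recompute; True; toWitness)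
open import Relation.Binary.Bundles using (Setoid)
open import Relation.Binary.PropositionalEquality
import Relation.Binary.Reasoning.Setoid
open import Defs

open +-*-Solver using (solve; _:+_; _:*_; _:-_; :-_; con; _:=_)

fromℤ : ℤ → ℚ
fromℤ z = mkℚ z 0 (Cop.sym (1-coprimeTo _))

fromℕ : ℕ → ℚ
fromℕ n = fromℤ (+ n)

fromℤ-* : ∀ a b → fromℤ a * fromℤ b ≡ fromℤ (a ℤ.* b)
fromℤ-* a b = ℚP.↥p/↧p≡p (fromℤ (a ℤ.* b))

fromℤ-+ : ∀ a b → fromℤ a + fromℤ b ≡ fromℤ (a ℤ.+ b)
fromℤ-+ a b = trans (cong₂ (λ x y → (x ℤ.+ y) / 1) (ℤP.*-identityʳ a) (ℤP.*-identityʳ b))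
                    (ℚP.↥p/↧p≡p (fromℤ (a ℤ.+ b)))

fromℕ-* : ∀ m n → fromℕ (m ℕ.* n) ≡ fromℕ m * fromℕ n
fromℕ-* m n = trans (cong fromℤ (ℤP.pos-* m n)) (sym (fromℤ-* (+ m) (+ n)))

fromℕ-+ : ∀ m n → fromℕ (m ℕ.+ n) ≡ fromℕ m + fromℕ n
fromℕ-+ m n = trans (cong fromℤ (ℤP.pos-+ m n)) (sym (fromℤ-+ (+ m) (+ n)))

^ℚ-+ : ∀ q e f → q ^ℚ (e ℕ.+ f) ≡ q ^ℚ e * q ^ℚ f
^ℚ-+ q zero    f = sym (ℚP.*-identityˡ (q ^ℚ f))
^ℚ-+ q (suc e) f = trans (cong (q *_) (^ℚ-+ q e f)) (sym (ℚP.*-assoc q (q ^ℚ e) (q ^ℚ f)))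

invPow-inverse : ∀ k → 1 ≤ k → invPow k 1 * fromℕ k ≡ 1ℚ
invPow-inverse (suc i) _ = begin
  (+ 1 / suc i) * 1ℚ * fromℕ (suc i)    ≡⟨ cong (_* fromℕ (suc i)) (ℚP.*-identityʳ (+ 1 / suc i)) ⟩
  (+ 1 / suc i) * fromℕ (suc i)          ≡⟨ cong (_* fromℕ (suc i)) (ℚP.normalize-coprime {1} {i} (1-coprimeTo (suc i))) ⟩
  ℚ.1/ (fromℕ (suc i)) * fromℕ (suc i)   ≡⟨ ℚP.*-inverseˡ (fromℕ (suc i)) ⟩
  1ℚ                                     ∎
  where open ≡-Reasoning

invPow-^ : ∀ k m → 1 ≤ k → invPow k m ≡ invPow k 1 ^ℚ m
invPow-^ (suc i) m _ = cong (_^ℚ m) (sym (ℚP.*-identityʳ (+ 1 / suc i)))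

inverse-unique : ∀ x y k → x * k ≡ 1ℚ → y * k ≡ 1ℚ → x ≡ y
inverse-unique x y k xk≡1 yk≡1 = begin
  x             ≡⟨ sym (ℚP.*-identityʳ x) ⟩
  x * 1ℚ        ≡⟨ cong (x *_) (sym yk≡1) ⟩
  x * (y * k)   ≡⟨ solve 3 (λ x y k → x :* (y :* k) := y :* (x :* k)) refl x y k ⟩
  y * (x * k)   ≡⟨ cong (y *_) xk≡1 ⟩
  y * 1ℚ        ≡⟨ ℚP.*-identityʳ y ⟩
  y             ∎
  where open ≡-Reasoning

inverses-of-complements : ∀ a b n k → a * k ≡ 1ℚ → b * (n - k) ≡ 1ℚ → a + b ≡ n * (a * b)
inverses-of-complements a b n k ak≡1 b[n-k]≡1 = begin
  a + b                             ≡⟨ cong₂ _+_ (sym (ℚP.*-identityʳ a)) (sym (ℚP.*-identityʳ b)) ⟩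
  a * 1ℚ + b * 1ℚ                   ≡⟨ cong₂ (λ u v → a * u + b * v) (sym b[n-k]≡1) (sym ak≡1) ⟩
  a * (b * (n - k)) + b * (a * k)   ≡⟨ solve 4 (λ a b n k → a :* (b :* (n :- k)) :+ b :* (a :* k) := n :* (a :* b)) refl a b n k ⟩
  n * (a * b)                       ∎
  where open ≡-Reasoning

sumTo-cong : ∀ n f g → (∀ k → 1 ≤ k → k ≤ n → f k ≡ g k) → sumTo n f ≡ sumTo n g
sumTo-cong zero    f g f≡g = refl
sumTo-cong (suc n) f g f≡g =
  cong₂ _+_ (sumTo-cong n f g (λ k 1≤k k≤n → f≡g k 1≤k (ℕP.m≤n⇒m≤1+n k≤n))) (f≡g (suc n) (s≤s z≤n) ℕP.≤-refl)

sumTo-+ : ∀ n f g → sumTo n (λ k → f k + g k) ≡ sumTo n f + sumTo n g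
sumTo-+ zero    f g = refl
sumTo-+ (suc n) f g = trans (cong (_+ (f (suc n) + g (suc n))) (sumTo-+ n f g))
  (solve 4 (λ a b c d → (a :+ b) :+ (c :+ d) := (a :+ c) :+ (b :+ d)) refl (sumTo n f) (sumTo n g) (f (suc n)) (g (suc n)))

sumTo-*ˡ : ∀ n c f → sumTo n (λ k → c * f k) ≡ c * sumTo n f
sumTo-*ˡ zero    c f = sym (ℚP.*-zeroʳ c)
sumTo-*ˡ (suc n) c f = trans (cong (_+ (c * f (suc n))) (sumTo-*ˡ n c f)) (sym (ℚP.*-distribˡ-+ c (sumTo n f) (f (suc n))))

sumTo-neg : ∀ n f → sumTo n (λ k → - f k) ≡ - sumTo n f
sumTo-neg zero    f = refl
sumTo-neg (suc n) f = trans (cong (_+ (- f (suc n))) (sumTo-neg n f)) (sym (ℚP.neg-distrib-+ (sumTo n f) (f (suc n))))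

sumTo-minus : ∀ n f g → sumTo n (λ k → f k - g k) ≡ sumTo n f - sumTo n g
sumTo-minus n f g = trans (sumTo-+ n f (λ k → - g k)) (cong (λ t → sumTo n f + t) (sumTo-neg n g))

sumTo-suc : ∀ n f → sumTo (suc n) f ≡ f 1 + sumTo n (λ k → f (suc k))
sumTo-suc zero    f = trans (ℚP.+-identityˡ (f 1)) (sym (ℚP.+-identityʳ (f 1)))
sumTo-suc (suc n) f = trans (cong (_+ f (suc (suc n))) (sumTo-suc n f))
                            (ℚP.+-assoc (f 1) (sumTo n (λ k → f (suc k))) (f (suc (suc n))))

sumTo-reverse : ∀ n f → sumTo n f ≡ sumTo n (λ k → f (suc n ∸ k))
sumTo-reverse zero    f = refl
sumTo-reverse (suc n) f = begin
  sumTo (suc n) f                                   ≡⟨ sumTo-suc n f ⟩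
  f 1 + sumTo n (λ k → f (suc k))                   ≡⟨ cong (λ t → f 1 + t) (sumTo-reverse n (λ k → f (suc k))) ⟩
  f 1 + sumTo n (λ k → f (suc (suc n ∸ k)))
      ≡⟨ cong (λ t → f 1 + t) (sumTo-cong n _ _ (λ k _ k≤n → cong f (sym (ℕP.+-∸-assoc 1 (ℕP.m≤n⇒m≤1+n k≤n))))) ⟩
  f 1 + sumTo n (λ k → f (suc (suc n) ∸ k))         ≡⟨ ℚP.+-comm (f 1) _ ⟩
  sumTo n (λ k → f (suc (suc n) ∸ k)) + f 1         ≡⟨ cong (λ j → sumTo n (λ k → f (suc (suc n) ∸ k)) + f j) (sym (ℕP.m+n∸n≡m 1 n)) ⟩
  sumTo (suc n) (λ k → f (suc (suc n) ∸ k))         ∎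
  where open ≡-Reasoning

sumTo-split : ∀ m n f → sumTo (m ℕ.+ n) f ≡ sumTo m f + sumTo n (λ k → f (m ℕ.+ k))
sumTo-split m zero    f = trans (cong (λ t → sumTo t f) (ℕP.+-identityʳ m)) (sym (ℚP.+-identityʳ (sumTo m f)))
sumTo-split m (suc n) f = begin
  sumTo (m ℕ.+ suc n) f                                        ≡⟨ cong (λ t → sumTo t f) (ℕP.+-suc m n) ⟩
  sumTo (m ℕ.+ n) f + f (suc (m ℕ.+ n))                        ≡⟨ cong₂ _+_ (sumTo-split m n f) (cong f (sym (ℕP.+-suc m n))) ⟩
  sumTo m f + sumTo n (λ k → f (m ℕ.+ k)) + f (m ℕ.+ suc n)    ≡⟨ ℚP.+-assoc (sumTo m f) _ _ ⟩
  sumTo m f + sumTo (suc n) (λ k → f (m ℕ.+ k))                ∎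
  where open ≡-Reasoning

sumTo-telescope : ∀ n (F : ℕ → ℚ) → sumTo n (λ k → F k - F (k ∸ 1)) ≡ F n - F 0
sumTo-telescope zero    F = sym (ℚP.+-inverseʳ (F 0))
sumTo-telescope (suc n) F = trans (cong (_+ (F (suc n) - F n)) (sumTo-telescope n F))
  (solve 3 (λ a b c → (b :- a) :+ (c :- b) := c :- a) refl (F 0) (F n) (F (suc n)))

sumTo-odd-even : ∀ h g → sumTo (h ℕ.+ h) g ≡ sumTo h (λ j → g (ℕ.pred (j ℕ.+ j)) + g (j ℕ.+ j))
sumTo-odd-even zero    g = refl
sumTo-odd-even (suc h) g = begin
  sumTo (suc h ℕ.+ suc h) g                                   ≡⟨ cong (λ t → sumTo (suc t) g) (ℕP.+-suc h h) ⟩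
  sumTo (h ℕ.+ h) g + g (suc (h ℕ.+ h)) + g (suc (suc (h ℕ.+ h)))
                    ≡⟨ cong (λ t → t + g (suc (h ℕ.+ h)) + g (suc (suc (h ℕ.+ h)))) (sumTo-odd-even h g) ⟩
  S + g (suc (h ℕ.+ h)) + g (suc (suc (h ℕ.+ h)))             ≡⟨ ℚP.+-assoc S (g (suc (h ℕ.+ h))) (g (suc (suc (h ℕ.+ h)))) ⟩
  S + (g (suc (h ℕ.+ h)) + g (suc (suc (h ℕ.+ h))))           ≡⟨ cong (λ t → S + (g (ℕ.pred t) + g t)) (sym (ℕP.+-suc (suc h) h)) ⟩
  sumTo (suc h) (λ j → g (ℕ.pred (j ℕ.+ j)) + g (j ℕ.+ j))    ∎
  where
  open ≡-Reasoning
  S = sumTo h (λ j → g (ℕ.pred (j ℕ.+ j)) + g (j ℕ.+ j))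

sum-of-cubes : ∀ a b n → a + b ≡ n * (a * b) →
  a ^ℚ 3 + b ^ℚ 3 ≡ n * (n * (n * (a * b * (a * b * (a * b))))) - fromℕ 3 * (n * (a * b * (a * b)))
sum-of-cubes a b n a+b≡nab = begin
  a ^ℚ 3 + b ^ℚ 3                                              ≡⟨ solve 2 (λ a b → a :* (a :* (a :* con 1ℚ)) :+ b :* (b :* (b :* con 1ℚ))
                                                                  := (a :+ b) :* ((a :+ b) :* (a :+ b)) :- con (fromℕ 3) :* ((a :* b) :* (a :+ b))) refl a b ⟩
  (a + b) * ((a + b) * (a + b)) - fromℕ 3 * (a * b * (a + b))  ≡⟨ cong (λ s → s * (s * s) - fromℕ 3 * (a * b * s)) a+b≡nab ⟩
  (n * y) * ((n * y) * (n * y)) - fromℕ 3 * (y * (n * y))      ≡⟨ solve 2 (λ n y → (n :* y) :* ((n :* y) :* (n :* y)) :- con (fromℕ 3) :* (y :* (n :* y))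
                                                                  := n :* (n :* (n :* (y :* (y :* y)))) :- con (fromℕ 3) :* (n :* (y :* y))) refl n y ⟩
  n * (n * (n * (y * (y * y)))) - fromℕ 3 * (n * (y * y))      ∎
  where
  open ≡-Reasoning
  y = a * b

ΔH₁/k³≡1/k⁴ : ∀ k → 1 ≤ k → H₁ k * invPow k 3 - H₁ (k ∸ 1) * invPow k 3 ≡ invPow k 4
ΔH₁/k³≡1/k⁴ (suc i) _ = solve 2 (λ h u → (h :+ u :* con 1ℚ) :* (u :* (u :* (u :* con 1ℚ))) :- h :* (u :* (u :* (u :* con 1ℚ)))
                                        := u :* (u :* (u :* (u :* con 1ℚ)))) refl (H₁ i) (+ 1 / suc i)

ΔH₃/k≡1/k⁴ : ∀ k → 1 ≤ k → H k 3 * invPow k 1 - H (k ∸ 1) 3 * invPow k 1 ≡ invPow k 4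
ΔH₃/k≡1/k⁴ (suc i) _ = solve 2 (λ h u → (h :+ u :* (u :* (u :* con 1ℚ))) :* (u :* con 1ℚ) :- h :* (u :* con 1ℚ)
                                       := u :* (u :* (u :* (u :* con 1ℚ)))) refl (H i 3) (+ 1 / suc i)

ΔH₁³ : ∀ k → 1 ≤ k → H₁ k ^ℚ 3 - H₁ (k ∸ 1) ^ℚ 3
                     ≡ fromℕ 3 * ((H₁ k ^ℚ 2) * invPow k 1) - fromℕ 3 * (H₁ k * invPow k 2) + invPow k 3
ΔH₁³ (suc i) _ = solve 2 (λ h u → let h′ = h :+ u :* con 1ℚ in
    h′ :* (h′ :* (h′ :* con 1ℚ)) :- h :* (h :* (h :* con 1ℚ))
      := con (fromℕ 3) :* ((h′ :* (h′ :* con 1ℚ)) :* (u :* con 1ℚ)) :- con (fromℕ 3) :* (h′ :* (u :* (u :* con 1ℚ)))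
         :+ u :* (u :* (u :* con 1ℚ)))
  refl (H₁ i) (+ 1 / suc i)

ΔH₁⁴ : ∀ k → 1 ≤ k → H₁ k ^ℚ 4 - H₁ (k ∸ 1) ^ℚ 4
                     ≡ fromℕ 4 * ((H₁ k ^ℚ 3) * invPow k 1) - fromℕ 6 * ((H₁ k ^ℚ 2) * invPow k 2)
                       + (fromℕ 4 * (H₁ k * invPow k 3) - invPow k 4)
ΔH₁⁴ (suc i) _ = solve 2 (λ h u → let h′ = h :+ u :* con 1ℚ in
    h′ :* (h′ :* (h′ :* (h′ :* con 1ℚ))) :- h :* (h :* (h :* (h :* con 1ℚ)))
      := con (fromℕ 4) :* ((h′ :* (h′ :* (h′ :* con 1ℚ))) :* (u :* con 1ℚ))
         :- con (fromℕ 6) :* ((h′ :* (h′ :* con 1ℚ)) :* (u :* (u :* con 1ℚ)))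
         :+ (con (fromℕ 4) :* (h′ :* (u :* (u :* (u :* con 1ℚ)))) :- u :* (u :* (u :* (u :* con 1ℚ)))))
  refl (H₁ i) (+ 1 / suc i)

module Localisation (p : ℕ) (p-prime : Prime p) where

  instance
    p-nonZero : ℕ.NonZero p
    p-nonZero = prime⇒nonZero p-prime

  p∤1 : ¬ (p ∣ 1)
  p∤1 p∣1 = ℕ.nonTrivial⇒≢1 {{prime⇒nonTrivial p-prime}} (ℕD.∣1⇒≡1 p∣1)

  p∤-* : ∀ {b d} → ¬ (p ∣ b) → ¬ (p ∣ d) → ¬ (p ∣ b ℕ.* d)
  p∤-* {b} {d} p∤b p∤d p∣bd with euclidsLemma b d p-prime p∣bd
  ... | inj₁ p∣b = p∤b p∣b
  ... | inj₂ p∣d = p∤d p∣d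

  p∤<p : ∀ c → 1 ≤ c → c < p → ¬ (p ∣ c)
  p∤<p (suc c) _ c<p p∣c = ℕP.<⇒≱ c<p (ℕD.∣⇒≤ p∣c)

  -- membership in the local ring ℤ₍ₚ₎
  record Integral (x : ℚ) : Set where
    constructor integral
    field
      numerator   : ℤ
      denominator : ℕ
      p∤denominator : ¬ (p ∣ denominator)
      cleared : x * fromℕ denominator ≡ fromℤ numerator

  integral-fromℤ : ∀ z → Integral (fromℤ z)
  integral-fromℤ z = integral z 1 p∤1 (trans (fromℤ-* z (+ 1)) (cong fromℤ (ℤP.*-identityʳ z)))

  integral-inverse : ∀ x c → ¬ (p ∣ c) → x * fromℕ c ≡ 1ℚ → Integral x
  integral-inverse x c p∤c xc≡1 = integral (+ 1) c p∤c xc≡1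

  integral-+ : ∀ {x y} → Integral x → Integral y → Integral (x + y)
  integral-+ {x} {y} (integral a b p∤b xb≡a) (integral c d p∤d yd≡c) = integral (a ℤ.* + d ℤ.+ c ℤ.* + b) (b ℕ.* d) (p∤-* p∤b p∤d) (begin
    (x + y) * fromℕ (b ℕ.* d)                             ≡⟨ cong ((x + y) *_) (fromℕ-* b d) ⟩
    (x + y) * (fromℕ b * fromℕ d)
        ≡⟨ solve 4 (λ x y B D → (x :+ y) :* (B :* D) := (x :* B) :* D :+ (y :* D) :* B) refl x y (fromℕ b) (fromℕ d) ⟩
    (x * fromℕ b) * fromℕ d + (y * fromℕ d) * fromℕ b     ≡⟨ cong₂ (λ u v → u * fromℕ d + v * fromℕ b) xb≡a yd≡c ⟩
    fromℤ a * fromℕ d + fromℤ c * fromℕ b                 ≡⟨ cong₂ _+_ (fromℤ-* a (+ d)) (fromℤ-* c (+ b)) ⟩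
    fromℤ (a ℤ.* + d) + fromℤ (c ℤ.* + b)                 ≡⟨ fromℤ-+ (a ℤ.* + d) (c ℤ.* + b) ⟩
    fromℤ (a ℤ.* + d ℤ.+ c ℤ.* + b)                       ∎)
    where open ≡-Reasoning

  integral-* : ∀ {x y} → Integral x → Integral y → Integral (x * y)
  integral-* {x} {y} (integral a b p∤b xb≡a) (integral c d p∤d yd≡c) = integral (a ℤ.* c) (b ℕ.* d) (p∤-* p∤b p∤d) (begin
    (x * y) * fromℕ (b ℕ.* d)                 ≡⟨ cong ((x * y) *_) (fromℕ-* b d) ⟩
    (x * y) * (fromℕ b * fromℕ d)             ≡⟨ solve 4 (λ x y B D → (x :* y) :* (B :* D) := (x :* B) :* (y :* D)) refl x y (fromℕ b) (fromℕ d) ⟩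
    (x * fromℕ b) * (y * fromℕ d)             ≡⟨ cong₂ _*_ xb≡a yd≡c ⟩
    fromℤ a * fromℤ c                         ≡⟨ fromℤ-* a c ⟩
    fromℤ (a ℤ.* c)                           ∎)
    where open ≡-Reasoning

  integral-neg : ∀ {x} → Integral x → Integral (- x)
  integral-neg {x} x∈ = subst Integral (solve 1 (λ x → con (- 1ℚ) :* x := :- x) refl x)
                               (integral-* (integral-fromℤ (ℤ.- + 1)) x∈)

  integral-^ : ∀ {x} m → Integral x → Integral (x ^ℚ m)
  integral-^ zero    x∈ = integral-fromℤ (+ 1)
  integral-^ (suc m) x∈ = integral-* x∈ (integral-^ m x∈)

  integral-sumTo : ∀ n f → (∀ k → 1 ≤ k → k ≤ n → Integral (f k)) → Integral (sumTo n f)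
  integral-sumTo zero    f f∈ = integral-fromℤ (+ 0)
  integral-sumTo (suc n) f f∈ =
    integral-+ (integral-sumTo n f (λ k 1≤k k≤n → f∈ k 1≤k (ℕP.m≤n⇒m≤1+n k≤n))) (f∈ (suc n) (s≤s z≤n) ℕP.≤-refl)

  pℚ : ℚ
  pℚ = fromℕ p

  infix 4 p^_∣ℚ_
  record p^_∣ℚ_ (e : ℕ) (x : ℚ) : Set where
    constructor multiple
    field
      quotient          : ℚ
      quotient-integral : Integral quotient
      factorisation     : x ≡ pℚ ^ℚ e * quotient

  ∣ℚ-0 : ∀ e → p^ e ∣ℚ 0ℚ
  ∣ℚ-0 e = multiple 0ℚ (integral-fromℤ (+ 0)) (sym (ℚP.*-zeroʳ (pℚ ^ℚ e)))

  ∣ℚ-+ : ∀ {e x y} → p^ e ∣ℚ x → p^ e ∣ℚ y → p^ e ∣ℚ (x + y)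
  ∣ℚ-+ {e} (multiple u u∈ x≡) (multiple v v∈ y≡) =
    multiple (u + v) (integral-+ u∈ v∈) (trans (cong₂ _+_ x≡ y≡) (sym (ℚP.*-distribˡ-+ (pℚ ^ℚ e) u v)))

  ∣ℚ-*ˡ : ∀ {e z x} → Integral z → p^ e ∣ℚ x → p^ e ∣ℚ (z * x)
  ∣ℚ-*ˡ {e} {z} z∈ (multiple u u∈ x≡) = multiple (z * u) (integral-* z∈ u∈)
    (trans (cong (z *_) x≡) (solve 3 (λ z q u → z :* (q :* u) := q :* (z :* u)) refl z (pℚ ^ℚ e) u))

  ∣ℚ-*ʳ : ∀ {e x z} → p^ e ∣ℚ x → Integral z → p^ e ∣ℚ (x * z)
  ∣ℚ-*ʳ {x = x} {z} x∣ z∈ = subst (p^ _ ∣ℚ_) (ℚP.*-comm z x) (∣ℚ-*ˡ z∈ x∣)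

  ∣ℚ-* : ∀ {e f x y} → p^ e ∣ℚ x → p^ f ∣ℚ y → p^ (e ℕ.+ f) ∣ℚ (x * y)
  ∣ℚ-* {e} {f} (multiple u u∈ x≡) (multiple v v∈ y≡) = multiple (u * v) (integral-* u∈ v∈)
    (trans (cong₂ _*_ x≡ y≡) (trans (solve 4 (λ P Q u v → (P :* u) :* (Q :* v) := (P :* Q) :* (u :* v)) refl (pℚ ^ℚ e) (pℚ ^ℚ f) u v)
                                    (cong (_* (u * v)) (sym (^ℚ-+ pℚ e f)))))

  ∣ℚ-neg : ∀ {e x} → p^ e ∣ℚ x → p^ e ∣ℚ (- x)
  ∣ℚ-neg {x = x} x∣ = subst (p^ _ ∣ℚ_) (solve 1 (λ x → con (- 1ℚ) :* x := :- x) refl x) (∣ℚ-*ˡ (integral-fromℤ (ℤ.- + 1)) x∣)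

  ∣ℚ-minus : ∀ {e x y} → p^ e ∣ℚ x → p^ e ∣ℚ y → p^ e ∣ℚ (x - y)
  ∣ℚ-minus x∣ y∣ = ∣ℚ-+ x∣ (∣ℚ-neg y∣)

  p^0∣ℚ : ∀ {x} → Integral x → p^ 0 ∣ℚ x
  p^0∣ℚ {x} x∈ = multiple x x∈ (sym (ℚP.*-identityˡ x))

  ∣ℚ-pℚ* : ∀ {e x} → p^ e ∣ℚ x → p^ suc e ∣ℚ (pℚ * x)
  ∣ℚ-pℚ* {e} (multiple u u∈ x≡) = multiple u u∈ (trans (cong (pℚ *_) x≡) (sym (ℚP.*-assoc pℚ (pℚ ^ℚ e) u)))

  ∣ℚ-weaken : ∀ {e x} → p^ suc e ∣ℚ x → p^ e ∣ℚ x
  ∣ℚ-weaken {e} (multiple u u∈ x≡) = multiple (pℚ * u) (integral-* (integral-fromℤ (+ p)) u∈)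
    (trans x≡ (solve 3 (λ P Q u → (P :* Q) :* u := Q :* (P :* u)) refl pℚ (pℚ ^ℚ e) u))

  ∣ℚ⇒integral : ∀ {e x} → p^ e ∣ℚ x → Integral x
  ∣ℚ⇒integral {e} (multiple u u∈ x≡) = subst Integral (sym x≡) (integral-* (integral-^ e (integral-fromℤ (+ p))) u∈)

  ∣ℚ-cancel : ∀ {e x} c → ¬ (p ∣ c) → p^ e ∣ℚ (fromℕ c * x) → p^ e ∣ℚ x
  ∣ℚ-cancel zero    p∤0 _ = ⊥-elim (p∤0 (p ℕD.∣0))
  ∣ℚ-cancel {x = x} c@(suc _) p∤c cx∣ = subst (p^ _ ∣ℚ_) c⁻¹cx≡x (∣ℚ-*ˡ c⁻¹∈ cx∣)
    where
    c⁻¹∈ : Integral (invPow c 1)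
    c⁻¹∈ = integral-inverse (invPow c 1) c p∤c (invPow-inverse c (s≤s z≤n))
    c⁻¹cx≡x : invPow c 1 * (fromℕ c * x) ≡ x
    c⁻¹cx≡x = begin
      invPow c 1 * (fromℕ c * x)   ≡⟨ sym (ℚP.*-assoc (invPow c 1) (fromℕ c) x) ⟩
      invPow c 1 * fromℕ c * x     ≡⟨ cong (_* x) (invPow-inverse c (s≤s z≤n)) ⟩
      1ℚ * x                       ≡⟨ ℚP.*-identityˡ x ⟩
      x                            ∎
      where open ≡-Reasoning

  ∣ℚ-sumTo : ∀ {e} n f → (∀ k → 1 ≤ k → k ≤ n → p^ e ∣ℚ f k) → p^ e ∣ℚ sumTo n f
  ∣ℚ-sumTo {e} zero    f f∣ = ∣ℚ-0 e
  ∣ℚ-sumTo     (suc n) f f∣ =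
    ∣ℚ-+ (∣ℚ-sumTo n f (λ k 1≤k k≤n → f∣ k 1≤k (ℕP.m≤n⇒m≤1+n k≤n))) (f∣ (suc n) (s≤s z≤n) ℕP.≤-refl)

  infix 4 _≈_[mod-p^_]
  record _≈_[mod-p^_] (x y : ℚ) (e : ℕ) : Set where
    constructor mod-p^
    field
      ∣ℚ-difference : p^ e ∣ℚ (x - y)

  open _≈_[mod-p^_] public

  ≈-reflexive : ∀ {e x y} → x ≡ y → x ≈ y [mod-p^ e ]
  ≈-reflexive {e} {x} refl = mod-p^ (subst (p^ e ∣ℚ_) (sym (ℚP.+-inverseʳ x)) (∣ℚ-0 e))

  ≈-sym : ∀ {e x y} → x ≈ y [mod-p^ e ] → y ≈ x [mod-p^ e ]
  ≈-sym {x = x} {y} (mod-p^ d) = mod-p^ (subst (p^ _ ∣ℚ_) (solve 2 (λ x y → :- (x :- y) := y :- x) refl x y) (∣ℚ-neg d))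

  ≈-trans : ∀ {e x y z} → x ≈ y [mod-p^ e ] → y ≈ z [mod-p^ e ] → x ≈ z [mod-p^ e ]
  ≈-trans {x = x} {y} {z} (mod-p^ d) (mod-p^ d') =
    mod-p^ (subst (p^ _ ∣ℚ_) (solve 3 (λ x y z → (x :- y) :+ (y :- z) := x :- z) refl x y z) (∣ℚ-+ d d'))

  ≈-setoid : ℕ → Setoid _ _
  ≈-setoid e = record
    { Carrier       = ℚ
    ; _≈_           = λ x y → x ≈ y [mod-p^ e ]
    ; isEquivalence = record { refl = ≈-reflexive refl ; sym = ≈-sym ; trans = ≈-trans }
    }

  module ≈-Reasoning (e : ℕ) = Relation.Binary.Reasoning.Setoid (≈-setoid e)

  ≈-+ : ∀ {e x x' y y'} → x ≈ x' [mod-p^ e ] → y ≈ y' [mod-p^ e ] → x + y ≈ x' + y' [mod-p^ e ]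
  ≈-+ {x = x} {x'} {y} {y'} (mod-p^ d) (mod-p^ d') =
    mod-p^ (subst (p^ _ ∣ℚ_) (solve 4 (λ x x' y y' → (x :- x') :+ (y :- y') := (x :+ y) :- (x' :+ y')) refl x x' y y') (∣ℚ-+ d d'))

  ≈-neg : ∀ {e x x'} → x ≈ x' [mod-p^ e ] → - x ≈ - x' [mod-p^ e ]
  ≈-neg {x = x} {x'} (mod-p^ d) =
    mod-p^ (subst (p^ _ ∣ℚ_) (solve 2 (λ x x' → :- (x :- x') := (:- x) :- (:- x')) refl x x') (∣ℚ-neg d))

  ≈-*ˡ : ∀ {e z x x'} → Integral z → x ≈ x' [mod-p^ e ] → z * x ≈ z * x' [mod-p^ e ]
  ≈-*ˡ {z = z} {x} {x'} z∈ (mod-p^ d) =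
    mod-p^ (subst (p^ _ ∣ℚ_) (solve 3 (λ z x x' → z :* (x :- x') := z :* x :- z :* x') refl z x x') (∣ℚ-*ˡ z∈ d))

  ≈-* : ∀ {e x x' y y'} → Integral x → Integral y' → x ≈ x' [mod-p^ e ] → y ≈ y' [mod-p^ e ] → x * y ≈ x' * y' [mod-p^ e ]
  ≈-* {x = x} {x'} {y} {y'} x∈ y'∈ (mod-p^ d) (mod-p^ d') =
    mod-p^ (subst (p^ _ ∣ℚ_) (solve 4 (λ x x' y y' → x :* (y :- y') :+ y' :* (x :- x') := x :* y :- x' :* y') refl x x' y y')
                             (∣ℚ-+ (∣ℚ-*ˡ x∈ d') (∣ℚ-*ˡ y'∈ d)))

  ≈-^ : ∀ {e x x'} m → Integral x → Integral x' → x ≈ x' [mod-p^ e ] → x ^ℚ m ≈ x' ^ℚ m [mod-p^ e ]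
  ≈-^ zero    x∈ x'∈ x≈x' = ≈-reflexive refl
  ≈-^ (suc m) x∈ x'∈ x≈x' = ≈-* x∈ (integral-^ m x'∈) x≈x' (≈-^ m x∈ x'∈ x≈x')

  ≈-pℚ* : ∀ {e x x'} → x ≈ x' [mod-p^ e ] → pℚ * x ≈ pℚ * x' [mod-p^ suc e ]
  ≈-pℚ* {x = x} {x'} (mod-p^ d) =
    mod-p^ (subst (p^ _ ∣ℚ_) (solve 3 (λ P x x' → P :* (x :- x') := P :* x :- P :* x') refl pℚ x x') (∣ℚ-pℚ* d))

  ∣ℚ⇒≈0 : ∀ {e x} → p^ e ∣ℚ x → x ≈ 0ℚ [mod-p^ e ]
  ∣ℚ⇒≈0 {x = x} x∣ = mod-p^ (subst (p^ _ ∣ℚ_) (sym (ℚP.+-identityʳ x)) x∣)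

  ≈0⇒∣ℚ : ∀ {e x} → x ≈ 0ℚ [mod-p^ e ] → p^ e ∣ℚ x
  ≈0⇒∣ℚ {x = x} (mod-p^ d) = subst (p^ _ ∣ℚ_) (ℚP.+-identityʳ x) d

  ≈-sumTo : ∀ {e} n f g → (∀ k → 1 ≤ k → k ≤ n → f k ≈ g k [mod-p^ e ]) → sumTo n f ≈ sumTo n g [mod-p^ e ]
  ≈-sumTo n f g f≈g = mod-p^ (subst (p^ _ ∣ℚ_) (sumTo-minus n f g)
    (∣ℚ-sumTo n (λ k → f k - g k) (λ k 1≤k k≤n → ∣ℚ-difference (f≈g k 1≤k k≤n))))

  p^e∣m*b⇒p^e∣m : ∀ e m {b} → ¬ (p ∣ b) → (p ℕ.^ e) ∣ m ℕ.* b → (p ℕ.^ e) ∣ m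
  p^e∣m*b⇒p^e∣m zero    m p∤b _ = ℕD.1∣ m
  p^e∣m*b⇒p^e∣m (suc e) m {b} p∤b p^e∣mb with euclidsLemma m b p-prime (ℕD.∣-trans (ℕD.m∣m*n (p ℕ.^ e)) p^e∣mb)
  ... | inj₂ p∣b = ⊥-elim (p∤b p∣b)
  ... | inj₁ (divides m' refl) = subst ((p ℕ.* p ℕ.^ e) ∣_) (ℕP.*-comm p m') (ℕD.*-monoʳ-∣ p (p^e∣m*b⇒p^e∣m e m' p∤b p^e∣m'b))
    where
    p^e∣m'b : (p ℕ.^ e) ∣ m' ℕ.* b
    p^e∣m'b = ℕD.*-cancelˡ-∣ p (subst ((p ℕ.* p ℕ.^ e) ∣_) (trans (cong (ℕ._* b) (ℕP.*-comm m' p)) (ℕP.*-assoc p m' b)) p^e∣mb)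

  reduced-fraction-valuation : ∀ e m d b a → Coprime m d → ¬ (p ∣ b) → m ℕ.* b ≡ p ℕ.^ e ℕ.* a ℕ.* d →
    (¬ (p ∣ d)) × ((p ℕ.^ e) ∣ m)
  reduced-fraction-valuation e m d b a m⊥d p∤b mb≡ = p∤d , p^e∣m*b⇒p^e∣m e m p∤b (divides (a ℕ.* d) (trans mb≡ rearrange))
    where
    rearrange : p ℕ.^ e ℕ.* a ℕ.* d ≡ a ℕ.* d ℕ.* p ℕ.^ e
    rearrange = trans (ℕP.*-assoc (p ℕ.^ e) a d) (ℕP.*-comm (p ℕ.^ e) (a ℕ.* d))
    p∤d : ¬ (p ∣ d)
    p∤d p∣d with euclidsLemma m b p-prime (subst (p ∣_) (sym mb≡) (ℕD.∣-trans p∣d (ℕD.n∣m*n (p ℕ.^ e ℕ.* a))))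
    ... | inj₂ p∣b = p∤b p∣b
    ... | inj₁ p∣m = p∤1 (subst (p ∣_) (m⊥d (p∣m , p∣d)) ℕD.∣-refl)

  pℚ^≡fromℕ : ∀ e → pℚ ^ℚ e ≡ fromℕ (p ℕ.^ e)
  pℚ^≡fromℕ zero    = refl
  pℚ^≡fromℕ (suc e) = trans (cong (pℚ *_) (pℚ^≡fromℕ e)) (sym (fromℕ-* p (p ℕ.^ e)))

  ∣ℚ⇒reduced : ∀ {e} q → p^ e ∣ℚ q → (¬ (p ∣ ↧ₙ q)) × ((p ℕ.^ e) ∣ ℤ.∣ ↥ q ∣)
  ∣ℚ⇒reduced {e} q@(mkℚ m d-1 coprime) (multiple u (integral a b p∤b ub≡a) q≡) with ℚP.toℚᵘ-cong qb≡
    where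
    qb≡ : q * fromℕ b ≡ fromℤ (+ (p ℕ.^ e) ℤ.* a)
    qb≡ = begin
      q * fromℕ b                   ≡⟨ cong (_* fromℕ b) q≡ ⟩
      pℚ ^ℚ e * u * fromℕ b         ≡⟨ ℚP.*-assoc (pℚ ^ℚ e) u (fromℕ b) ⟩
      pℚ ^ℚ e * (u * fromℕ b)       ≡⟨ cong₂ _*_ (pℚ^≡fromℕ e) ub≡a ⟩
      fromℕ (p ℕ.^ e) * fromℤ a     ≡⟨ fromℤ-* (+ (p ℕ.^ e)) a ⟩
      fromℤ (+ (p ℕ.^ e) ℤ.* a)     ∎
      where open ≡-Reasoning
  ... | qbᵘ≃ with ℚᵘP.≃-trans (ℚᵘP.≃-sym (ℚP.toℚᵘ-homo-* q (fromℕ b))) qbᵘ≃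
  ... | ℚᵘ.*≡* mb≡ = reduced-fraction-valuation e ℤ.∣ m ∣ (suc d-1) b ℤ.∣ a ∣ m⊥d p∤b (begin
      ℤ.∣ m ∣ ℕ.* b                                      ≡⟨ sym (ℕP.*-identityʳ _) ⟩
      ℤ.∣ m ∣ ℕ.* b ℕ.* 1                                ≡⟨ sym (cong (ℕ._* 1) (ℤP.abs-* m (+ b))) ⟩
      ℤ.∣ m ℤ.* + b ∣ ℕ.* 1                              ≡⟨ sym (ℤP.abs-* (m ℤ.* + b) (+ 1)) ⟩
      ℤ.∣ m ℤ.* + b ℤ.* + 1 ∣                            ≡⟨ cong ℤ.∣_∣ mb≡ ⟩
      ℤ.∣ + (p ℕ.^ e) ℤ.* a ℤ.* + (suc d-1 ℕ.* 1) ∣      ≡⟨ ℤP.abs-* (+ (p ℕ.^ e) ℤ.* a) (+ (suc d-1 ℕ.* 1)) ⟩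
      ℤ.∣ + (p ℕ.^ e) ℤ.* a ∣ ℕ.* (suc d-1 ℕ.* 1)        ≡⟨ cong₂ ℕ._*_ (ℤP.abs-* (+ (p ℕ.^ e)) a) (ℕP.*-identityʳ (suc d-1)) ⟩
      p ℕ.^ e ℕ.* ℤ.∣ a ∣ ℕ.* suc d-1                    ∎)
    where
    open ≡-Reasoning
    m⊥d : Coprime ℤ.∣ m ∣ (suc d-1)
    m⊥d {i} i∣both = recompute (i ℕP.≟ 1) (coprime i∣both)

  ≈⇒≡mod : ∀ {e x y} → x ≈ y [mod-p^ e ] → x ≡ y mod p ^ e
  ≈⇒≡mod (mod-p^ x-y∣) = ∣ℚ⇒reduced _ x-y∣

parity : ∀ m → Σ ℕ λ h → (m ≡ h ℕ.+ h) ⊎ (m ≡ suc (h ℕ.+ h))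
parity zero = 0 , inj₁ refl
parity (suc m) with parity m
... | h , inj₁ m≡2h   = h , inj₂ (cong suc m≡2h)
... | h , inj₂ m≡2h+1 = suc h , inj₁ (trans (cong suc m≡2h+1) (cong suc (sym (ℕP.+-suc h h))))

sumTo-combination : ∀ n a b f g d → sumTo n (λ k → a * f k - b * g k + d k) ≡ a * sumTo n f - b * sumTo n g + sumTo n d
sumTo-combination n a b f g d = begin
  sumTo n (λ k → a * f k - b * g k + d k)                        ≡⟨ sumTo-+ n (λ k → a * f k - b * g k) d ⟩
  sumTo n (λ k → a * f k - b * g k) + sumTo n d                  ≡⟨ cong (_+ sumTo n d) (sumTo-minus n (λ k → a * f k) (λ k → b * g k)) ⟩
  sumTo n (λ k → a * f k) - sumTo n (λ k → b * g k) + sumTo n d  ≡⟨ cong₂ (λ x y → x - y + sumTo n d) (sumTo-*ˡ n a f) (sumTo-*ˡ n b g) ⟩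
  a * sumTo n f - b * sumTo n g + sumTo n d                      ∎
  where open ≡-Reasoning

module Harmonic (p : ℕ) (p-prime : Prime p) (p≥7 : p ≥ 7) where
  open Localisation p p-prime

  p∤ : ∀ c → {True (1 ℕ.≤? c)} → {True (c ℕ.≤? 6)} → ¬ (p ∣ c)
  p∤ c {1≤c} {c≤6} = p∤<p c (toWitness 1≤c) (ℕP.≤-trans (s≤s (toWitness c≤6)) p≥7)

  ∣ℚ-half : ∀ {e x} → p^ e ∣ℚ (x + x) → p^ e ∣ℚ x
  ∣ℚ-half {x = x} 2x∣ = ∣ℚ-cancel 2 (p∤ 2) (subst (p^ _ ∣ℚ_) (solve 1 (λ x → x :+ x := con (fromℕ 2) :* x) refl x) 2x∣)

  p-1 : ℕ
  p-1 = p ∸ 1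

  suc[p-1]≡p : suc p-1 ≡ p
  suc[p-1]≡p = trans (ℕP.+-comm 1 p-1) (ℕP.m∸n+n≡m (ℕP.≤-trans (s≤s z≤n) p≥7))

  ≤p-1⇒<p : ∀ {k} → k ≤ p-1 → k < p
  ≤p-1⇒<p {k} k≤p-1 = subst (k <_) suc[p-1]≡p (s≤s k≤p-1)

  1≤p∸k : ∀ k → k ≤ p-1 → 1 ≤ p ∸ k
  1≤p∸k k k≤p-1 = ℕP.m<n⇒0<n∸m (≤p-1⇒<p k≤p-1)

  p∸k≤p-1 : ∀ k → 1 ≤ k → p ∸ k ≤ p-1
  p∸k≤p-1 k 1≤k = ℕP.∸-monoʳ-≤ p 1≤k

  sumTo-reflect : ∀ f → sumTo p-1 f ≡ sumTo p-1 (λ k → f (p ∸ k))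
  sumTo-reflect f = trans (sumTo-reverse p-1 f) (cong (λ t → sumTo p-1 (λ k → f (t ∸ k))) suc[p-1]≡p)

  invPow-integral : ∀ k m → 1 ≤ k → k ≤ p-1 → Integral (invPow k m)
  invPow-integral k m 1≤k k≤p-1 = subst Integral (sym (invPow-^ k m 1≤k))
    (integral-^ m (integral-inverse (invPow k 1) k (p∤<p k 1≤k (≤p-1⇒<p k≤p-1)) (invPow-inverse k 1≤k)))

  invPow[p∸k]-integral : ∀ k m → 1 ≤ k → k ≤ p-1 → Integral (invPow (p ∸ k) m)
  invPow[p∸k]-integral k m 1≤k k≤p-1 = invPow-integral (p ∸ k) m (1≤p∸k k k≤p-1) (p∸k≤p-1 k 1≤k)

  H-integral : ∀ k m → k ≤ p-1 → Integral (H k m)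
  H-integral k m k≤p-1 = integral-sumTo k (λ j → invPow j m) (λ j 1≤j j≤k → invPow-integral j m 1≤j (ℕP.≤-trans j≤k k≤p-1))

  fromℕ[p∸k] : ∀ k → k ≤ p-1 → fromℕ (p ∸ k) ≡ pℚ - fromℕ k
  fromℕ[p∸k] k k≤p-1 = begin
    fromℕ (p ∸ k)                          ≡⟨ solve 2 (λ x y → x := (x :+ y) :- y) refl (fromℕ (p ∸ k)) (fromℕ k) ⟩
    (fromℕ (p ∸ k) + fromℕ k) - fromℕ k    ≡⟨ cong (_- fromℕ k) (sym (fromℕ-+ (p ∸ k) k)) ⟩
    fromℕ (p ∸ k ℕ.+ k) - fromℕ k          ≡⟨ cong (λ t → fromℕ t - fromℕ k) (ℕP.m∸n+n≡m (ℕP.<⇒≤ (≤p-1⇒<p k≤p-1))) ⟩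
    pℚ - fromℕ k                           ∎
    where open ≡-Reasoning

  inverse-reflection-sum : ∀ k → 1 ≤ k → k ≤ p-1 →
    invPow k 1 + invPow (p ∸ k) 1 ≡ pℚ * (invPow k 1 * invPow (p ∸ k) 1)
  inverse-reflection-sum k 1≤k k≤p-1 = inverses-of-complements (invPow k 1) (invPow (p ∸ k) 1) pℚ (fromℕ k) (invPow-inverse k 1≤k)
    (trans (cong (invPow (p ∸ k) 1 *_) (sym (fromℕ[p∸k] k k≤p-1))) (invPow-inverse (p ∸ k) (1≤p∸k k k≤p-1)))

  inverse-reflection : ∀ k → 1 ≤ k → k ≤ p-1 → invPow (p ∸ k) 1 ≈ - invPow k 1 [mod-p^ 1 ]
  inverse-reflection k 1≤k k≤p-1 = mod-p^ (multiple (a * b)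
    (integral-* (invPow-integral k 1 1≤k k≤p-1) (invPow[p∸k]-integral k 1 1≤k k≤p-1)) (begin
      b - - a           ≡⟨ solve 2 (λ a b → b :- (:- a) := a :+ b) refl a b ⟩
      a + b             ≡⟨ inverse-reflection-sum k 1≤k k≤p-1 ⟩
      pℚ * (a * b)      ≡⟨ cong (_* (a * b)) (sym (ℚP.*-identityʳ pℚ)) ⟩
      pℚ ^ℚ 1 * (a * b) ∎))
    where
    open ≡-Reasoning
    a = invPow k 1
    b = invPow (p ∸ k) 1

  invPow-reflection : ∀ k m → 1 ≤ k → k ≤ p-1 → invPow (p ∸ k) m ≈ (- invPow k 1) ^ℚ m [mod-p^ 1 ]
  invPow-reflection k m 1≤k k≤p-1 = ≈-trans (≈-reflexive (invPow-^ (p ∸ k) m (1≤p∸k k k≤p-1)))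
    (≈-^ m (invPow[p∸k]-integral k 1 1≤k k≤p-1) (integral-neg (invPow-integral k 1 1≤k k≤p-1)) (inverse-reflection k 1≤k k≤p-1))

  invPow-reflection-3 : ∀ k → 1 ≤ k → k ≤ p-1 → invPow (p ∸ k) 3 ≈ - invPow k 3 [mod-p^ 1 ]
  invPow-reflection-3 k 1≤k k≤p-1 = ≈-trans (invPow-reflection k 3 1≤k k≤p-1) (≈-reflexive (trans
    (solve 1 (λ a → (:- a) :* ((:- a) :* ((:- a) :* con 1ℚ)) := :- (a :* (a :* (a :* con 1ℚ)))) refl (invPow k 1))
    (cong -_ (sym (invPow-^ k 3 1≤k)))))

  invPow-reflection-4 : ∀ k → 1 ≤ k → k ≤ p-1 → invPow (p ∸ k) 4 ≈ invPow k 4 [mod-p^ 1 ]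
  invPow-reflection-4 k 1≤k k≤p-1 = ≈-trans (invPow-reflection k 4 1≤k k≤p-1) (≈-reflexive (trans
    (solve 1 (λ a → (:- a) :* ((:- a) :* ((:- a) :* ((:- a) :* con 1ℚ))) := a :* (a :* (a :* (a :* con 1ℚ)))) refl (invPow k 1))
    (sym (invPow-^ k 4 1≤k))))

  H[p-1]-symmetrised : ∀ m → H p-1 m + H p-1 m ≡ sumTo p-1 (λ k → invPow k m + invPow (p ∸ k) m)
  H[p-1]-symmetrised m = sym (trans (sumTo-+ p-1 (λ k → invPow k m) (λ k → invPow (p ∸ k) m))
                                    (cong (λ t → H p-1 m + t) (sym (sumTo-reflect (λ k → invPow k m)))))

  p∣H[p-1] : p^ 1 ∣ℚ H₁ p-1
  p∣H[p-1] = ∣ℚ-half (subst (p^ 1 ∣ℚ_) (sym (H[p-1]-symmetrised 1)) (∣ℚ-sumTo p-1 _ λ k 1≤k k≤p-1 →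
    subst (p^ 1 ∣ℚ_) (sym (inverse-reflection-sum k 1≤k k≤p-1))
          (∣ℚ-pℚ* (p^0∣ℚ (integral-* (invPow-integral k 1 1≤k k≤p-1) (invPow[p∸k]-integral k 1 1≤k k≤p-1))))))

  p-1-even : Σ ℕ λ h → p-1 ≡ h ℕ.+ h
  p-1-even with parity p-1
  ... | h , inj₁ p-1≡2h = h , p-1≡2h
  ... | h , inj₂ p-1≡2h+1 with prime⇒irreducible p-prime (divides (suc h) p≡[h+1]*2)
    where
    p≡[h+1]*2 : p ≡ suc h ℕ.* 2
    p≡[h+1]*2 = trans (sym suc[p-1]≡p) (trans (cong suc p-1≡2h+1) (2+2h≡[1+h]*2 h))
      where
      2+2h≡[1+h]*2 : ∀ h → suc (suc (h ℕ.+ h)) ≡ suc h ℕ.* 2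
      2+2h≡[1+h]*2 = ℕSolver.solve-∀
  ... | inj₁ ()
  ... | inj₂ 2≡p = ⊥-elim (p∤ 2 (subst (_∣ 2) 2≡p ℕD.∣-refl))

  module _ (h : ℕ) (p-1≡h+h : p-1 ≡ h ℕ.+ h) where

    p≡2h+1 : p ≡ suc (h ℕ.+ h)
    p≡2h+1 = trans (sym suc[p-1]≡p) (cong suc p-1≡h+h)

    h≤p-1 : h ≤ p-1
    h≤p-1 = subst (h ≤_) (sym p-1≡h+h) (ℕP.m≤m+n h h)

    odd-index-reflection : ∀ j → j ≤ h → ℕ.pred ((suc h ∸ j) ℕ.+ (suc h ∸ j)) ≡ p ∸ (j ℕ.+ j)
    odd-index-reflection j j≤h = begin
      ℕ.pred ((suc h ∸ j) ℕ.+ (suc h ∸ j))            ≡⟨ cong (λ x → ℕ.pred (x ℕ.+ x)) (ℕP.+-∸-assoc 1 j≤h) ⟩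
      t ℕ.+ suc t                                     ≡⟨ ℕP.+-suc t t ⟩
      suc (t ℕ.+ t)                                   ≡⟨ sym (ℕP.m+n∸n≡m (suc (t ℕ.+ t)) (j ℕ.+ j)) ⟩
      suc (t ℕ.+ t ℕ.+ (j ℕ.+ j)) ∸ (j ℕ.+ j)         ≡⟨ cong (λ x → suc x ∸ (j ℕ.+ j)) (regroup t j) ⟩
      suc ((t ℕ.+ j) ℕ.+ (t ℕ.+ j)) ∸ (j ℕ.+ j)       ≡⟨ cong (λ x → suc (x ℕ.+ x) ∸ (j ℕ.+ j)) (ℕP.m∸n+n≡m j≤h) ⟩
      suc (h ℕ.+ h) ∸ (j ℕ.+ j)                       ≡⟨ cong (_∸ (j ℕ.+ j)) (sym p≡2h+1) ⟩
      p ∸ (j ℕ.+ j)                                   ∎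
      where
      open ≡-Reasoning
      t = h ∸ j
      regroup : ∀ t j → t ℕ.+ t ℕ.+ (j ℕ.+ j) ≡ (t ℕ.+ j) ℕ.+ (t ℕ.+ j)
      regroup = ℕSolver.solve-∀

    upper-index-reflection : ∀ i → i ≤ h → h ℕ.+ (suc h ∸ i) ≡ p ∸ i
    upper-index-reflection i i≤h = trans (sym (ℕP.+-∸-assoc h (ℕP.m≤n⇒m≤1+n i≤h)))
      (cong (_∸ i) (trans (ℕP.+-suc h h) (sym p≡2h+1)))

    even-part : ℚ
    even-part = sumTo h (λ j → invPow (j ℕ.+ j) 4)

    H[p-1,4]≈2even-part : H p-1 4 ≈ even-part + even-part [mod-p^ 1 ]
    H[p-1,4]≈2even-part = begin
      H p-1 4                             ≡⟨ cong (λ t → sumTo t g) p-1≡h+h ⟩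
      sumTo (h ℕ.+ h) g                   ≡⟨ trans (sumTo-odd-even h g) (sumTo-+ h (λ j → g (ℕ.pred (j ℕ.+ j))) (λ j → g (j ℕ.+ j))) ⟩
      sumTo h (λ j → g (ℕ.pred (j ℕ.+ j))) + even-part
            ≡⟨ cong (_+ even-part) (trans (sumTo-reverse h _) (sumTo-cong h _ _ (λ j _ j≤h → cong g (odd-index-reflection j j≤h)))) ⟩
      sumTo h (λ j → g (p ∸ (j ℕ.+ j))) + even-part
            ≈⟨ ≈-+ (≈-sumTo h _ _ (λ j 1≤j j≤h → invPow-reflection-4 (j ℕ.+ j) (ℕP.≤-trans 1≤j (ℕP.m≤m+n j j))
                                                     (subst (j ℕ.+ j ≤_) (sym p-1≡h+h) (ℕP.+-mono-≤ j≤h j≤h))))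
                   (≈-reflexive refl) ⟩
      even-part + even-part               ∎
      where
      open ≈-Reasoning 1
      g = λ k → invPow k 4

    H[p-1,4]≈2H[h,4] : H p-1 4 ≈ H h 4 + H h 4 [mod-p^ 1 ]
    H[p-1,4]≈2H[h,4] = begin
      H p-1 4                              ≡⟨ trans (cong (λ t → sumTo t g) p-1≡h+h) (sumTo-split h h g) ⟩
      H h 4 + sumTo h (λ i → g (h ℕ.+ i))
            ≡⟨ cong (λ t → H h 4 + t) (trans (sumTo-reverse h _) (sumTo-cong h _ _ (λ i _ i≤h → cong g (upper-index-reflection i i≤h)))) ⟩
      H h 4 + sumTo h (λ i → g (p ∸ i))
            ≈⟨ ≈-+ (≈-reflexive {x = H h 4} refl)
                   (≈-sumTo h _ _ (λ i 1≤i i≤h → invPow-reflection-4 i 1≤i (ℕP.≤-trans i≤h h≤p-1))) ⟩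
      H h 4 + H h 4                        ∎
      where
      open ≈-Reasoning 1
      g = λ k → invPow k 4

    invPow-double : ∀ j → 1 ≤ j → invPow (j ℕ.+ j) 1 ≡ invPow 2 1 * invPow j 1
    invPow-double j 1≤j = inverse-unique _ _ (fromℕ (j ℕ.+ j)) (invPow-inverse (j ℕ.+ j) (ℕP.≤-trans 1≤j (ℕP.m≤m+n j j))) (begin
      invPow 2 1 * invPow j 1 * fromℕ (j ℕ.+ j)           ≡⟨ cong (invPow 2 1 * invPow j 1 *_) (fromℕ-+ j j) ⟩
      invPow 2 1 * invPow j 1 * (fromℕ j + fromℕ j)
          ≡⟨ solve 3 (λ w a J → w :* a :* (J :+ J) := (w :* (con 1ℚ :+ con 1ℚ)) :* (a :* J)) refl (invPow 2 1) (invPow j 1) (fromℕ j) ⟩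
      (invPow 2 1 * (1ℚ + 1ℚ)) * (invPow j 1 * fromℕ j)   ≡⟨ cong₂ _*_ (invPow-inverse 2 (s≤s z≤n)) (invPow-inverse j 1≤j) ⟩
      1ℚ * 1ℚ                                             ≡⟨ ℚP.*-identityˡ 1ℚ ⟩
      1ℚ                                                  ∎)
      where open ≡-Reasoning

    even-part≡H[h,4]/16 : even-part ≡ invPow 2 1 ^ℚ 4 * H h 4
    even-part≡H[h,4]/16 = trans (sumTo-cong h _ (λ j → invPow 2 1 ^ℚ 4 * invPow j 4) term) (sumTo-*ˡ h (invPow 2 1 ^ℚ 4) (λ j → invPow j 4))
      where
      term : ∀ j → 1 ≤ j → j ≤ h → invPow (j ℕ.+ j) 4 ≡ invPow 2 1 ^ℚ 4 * invPow j 4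
      term j 1≤j _ = begin
        invPow (j ℕ.+ j) 4                    ≡⟨ invPow-^ (j ℕ.+ j) 4 (ℕP.≤-trans 1≤j (ℕP.m≤m+n j j)) ⟩
        invPow (j ℕ.+ j) 1 ^ℚ 4               ≡⟨ cong (_^ℚ 4) (invPow-double j 1≤j) ⟩
        (invPow 2 1 * invPow j 1) ^ℚ 4        ≡⟨ solve 2 (λ w x → (w :* x) :* ((w :* x) :* ((w :* x) :* ((w :* x) :* con 1ℚ)))
                                                      := (w :* (w :* (w :* (w :* con 1ℚ)))) :* (x :* (x :* (x :* (x :* con 1ℚ))))) refl (invPow 2 1) (invPow j 1) ⟩
        invPow 2 1 ^ℚ 4 * invPow j 1 ^ℚ 4     ≡⟨ cong (invPow 2 1 ^ℚ 4 *_) (sym (invPow-^ j 4 1≤j)) ⟩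
        invPow 2 1 ^ℚ 4 * invPow j 4          ∎
        where open ≡-Reasoning

    -- 16 · (2 · H_{h,4}/16 − 2 · H_{h,4}) = −30 · H_{h,4}, and 2, 3, 5 are units mod p
    p∣H[h,4] : p^ 1 ∣ℚ H h 4
    p∣H[h,4] = ∣ℚ-cancel 2 (p∤ 2) (∣ℚ-cancel 3 (p∤ 3) (∣ℚ-cancel 5 (p∤ 5)
      (subst (p^ 1 ∣ℚ_) thirty (∣ℚ-neg (∣ℚ-*ˡ (integral-fromℤ (+ 16)) (∣ℚ-difference 2even-part≈2H[h,4]))))))
      where
      2even-part≈2H[h,4] : even-part + even-part ≈ H h 4 + H h 4 [mod-p^ 1 ]
      2even-part≈2H[h,4] = ≈-trans (≈-sym H[p-1,4]≈2even-part) H[p-1,4]≈2H[h,4]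
      thirty : - (fromℕ 16 * ((even-part + even-part) - (H h 4 + H h 4))) ≡ fromℕ 5 * (fromℕ 3 * (fromℕ 2 * H h 4))
      thirty = trans (cong (λ x → - (fromℕ 16 * ((x + x) - (H h 4 + H h 4)))) even-part≡H[h,4]/16)
        (solve 1 (λ y → :- (con (fromℕ 16) :* ((con (invPow 2 1 ^ℚ 4) :* y :+ con (invPow 2 1 ^ℚ 4) :* y) :- (y :+ y)))
                        := con (fromℕ 5) :* (con (fromℕ 3) :* (con (fromℕ 2) :* y))) refl (H h 4))

    p∣H[p-1,4]-given-half : p^ 1 ∣ℚ H p-1 4
    p∣H[p-1,4]-given-half = ≈0⇒∣ℚ (≈-trans H[p-1,4]≈2H[h,4] (∣ℚ⇒≈0 (∣ℚ-+ p∣H[h,4] p∣H[h,4])))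

  p∣H[p-1,4] : p^ 1 ∣ℚ H p-1 4
  p∣H[p-1,4] = p∣H[p-1,4]-given-half (proj₁ p-1-even) (proj₂ p-1-even)

  cubes-reflection : ∀ k → 1 ≤ k → k ≤ p-1 →
    invPow k 3 + invPow (p ∸ k) 3 ≈ - (fromℕ 3 * (pℚ * invPow k 4)) [mod-p^ 2 ]
  cubes-reflection k 1≤k k≤p-1 = begin
    invPow k 3 + invPow (p ∸ k) 3                        ≡⟨ cong₂ _+_ (invPow-^ k 3 1≤k) (invPow-^ (p ∸ k) 3 (1≤p∸k k k≤p-1)) ⟩
    a ^ℚ 3 + b ^ℚ 3                                      ≡⟨ sum-of-cubes a b pℚ (inverse-reflection-sum k 1≤k k≤p-1) ⟩
    pℚ * (pℚ * (pℚ * y³)) - fromℕ 3 * (pℚ * (y * y))     ≈⟨ ≈-+ p³y³≈0 (≈-neg (≈-*ˡ (integral-fromℤ (+ 3)) (≈-pℚ* y²≈a⁴))) ⟩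
    0ℚ - fromℕ 3 * (pℚ * invPow k 4)                     ≡⟨ ℚP.+-identityˡ _ ⟩
    - (fromℕ 3 * (pℚ * invPow k 4))                      ∎
    where
    open ≈-Reasoning 2
    a = invPow k 1
    b = invPow (p ∸ k) 1
    a∈ = invPow-integral k 1 1≤k k≤p-1
    y = a * b
    y∈ = integral-* a∈ (invPow[p∸k]-integral k 1 1≤k k≤p-1)
    y³ = y * (y * y)
    p³y³≈0 : pℚ * (pℚ * (pℚ * y³)) ≈ 0ℚ [mod-p^ 2 ]
    p³y³≈0 = ∣ℚ⇒≈0 (∣ℚ-pℚ* (∣ℚ-pℚ* (p^0∣ℚ (integral-* (integral-fromℤ (+ p)) (integral-* y∈ (integral-* y∈ y∈))))))
    y≈-a² : y ≈ a * - a [mod-p^ 1 ]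
    y≈-a² = ≈-*ˡ a∈ (inverse-reflection k 1≤k k≤p-1)
    y²≈a⁴ : y * y ≈ invPow k 4 [mod-p^ 1 ]
    y²≈a⁴ = ≈-trans (≈-* y∈ (integral-* a∈ (integral-neg a∈)) y≈-a² y≈-a²) (≈-reflexive (trans
      (solve 1 (λ a → (a :* (:- a)) :* (a :* (:- a)) := a :* (a :* (a :* (a :* con 1ℚ)))) refl a) (sym (invPow-^ k 4 1≤k))))

  p²∣H[p-1,3] : p^ 2 ∣ℚ H p-1 3
  p²∣H[p-1,3] = ∣ℚ-half (≈0⇒∣ℚ (begin
    H p-1 3 + H p-1 3                                    ≡⟨ H[p-1]-symmetrised 3 ⟩
    sumTo p-1 (λ k → invPow k 3 + invPow (p ∸ k) 3)      ≈⟨ ≈-sumTo p-1 _ _ cubes-reflection ⟩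
    sumTo p-1 (λ k → - (fromℕ 3 * (pℚ * invPow k 4)))    ≡⟨ sumTo-neg p-1 _ ⟩
    - sumTo p-1 (λ k → fromℕ 3 * (pℚ * invPow k 4))      ≡⟨ cong -_ (trans (sumTo-*ˡ p-1 (fromℕ 3) _) (cong (fromℕ 3 *_) (sumTo-*ˡ p-1 pℚ _))) ⟩
    - (fromℕ 3 * (pℚ * H p-1 4))                         ≈⟨ ∣ℚ⇒≈0 (∣ℚ-neg (∣ℚ-*ˡ (integral-fromℤ (+ 3)) (∣ℚ-pℚ* p∣H[p-1,4]))) ⟩
    0ℚ                                                   ∎))
    where open ≈-Reasoning 2

  H-reflection : ∀ m → (∀ i → 1 ≤ i → i ≤ p-1 → invPow (p ∸ i) m ≈ - invPow i m [mod-p^ 1 ]) → p^ 1 ∣ℚ H p-1 m →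
                 ∀ k → k ≤ p-1 → H (p-1 ∸ k) m ≈ H k m [mod-p^ 1 ]
  H-reflection m reflect p∣H k k≤p-1 = begin
    H (p-1 ∸ k) m       ≡⟨ solve 2 (λ x t → x := (x :+ t) :- t) refl (H (p-1 ∸ k) m) tail ⟩
    H (p-1 ∸ k) m + tail - tail
          ≡⟨ cong (_- tail) (sym (trans (cong (λ t → sumTo t g) (sym (ℕP.m∸n+n≡m k≤p-1))) (sumTo-split (p-1 ∸ k) k g))) ⟩
    H p-1 m - tail      ≈⟨ ≈-+ (∣ℚ⇒≈0 p∣H) (≈-neg tail≈-H) ⟩
    0ℚ - - H k m        ≡⟨ solve 1 (λ x → con 0ℚ :- (:- x) := x) refl (H k m) ⟩
    H k m               ∎
    where
    open ≈-Reasoning 1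
    g = λ i → invPow i m
    tail = sumTo k (λ i → g (p-1 ∸ k ℕ.+ i))
    upper-index : ∀ i → i ≤ k → p-1 ∸ k ℕ.+ (suc k ∸ i) ≡ p ∸ i
    upper-index i i≤k = trans (sym (ℕP.+-∸-assoc (p-1 ∸ k) (ℕP.m≤n⇒m≤1+n i≤k)))
      (cong (_∸ i) (trans (ℕP.+-suc (p-1 ∸ k) k) (trans (cong suc (ℕP.m∸n+n≡m k≤p-1)) suc[p-1]≡p)))
    tail≈-H : tail ≈ - H k m [mod-p^ 1 ]
    tail≈-H = begin
      tail                         ≡⟨ trans (sumTo-reverse k _) (sumTo-cong k _ _ (λ i _ i≤k → cong g (upper-index i i≤k))) ⟩
      sumTo k (λ i → g (p ∸ i))    ≈⟨ ≈-sumTo k _ _ (λ i 1≤i i≤k → reflect i 1≤i (ℕP.≤-trans i≤k k≤p-1)) ⟩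
      sumTo k (λ i → - g i)        ≡⟨ sumTo-neg k g ⟩
      - H k m                      ∎

  p∸k∸1≡p-1∸k : ∀ k → p ∸ k ∸ 1 ≡ p-1 ∸ k
  p∸k∸1≡p-1∸k k = trans (ℕP.∸-+-assoc p k 1) (trans (cong (p ∸_) (ℕP.+-comm k 1)) (sym (ℕP.∸-+-assoc p 1 k)))

  antisymmetric-sums≈0 : (F w : ℕ → ℚ) →
    (∀ k → k ≤ p-1 → Integral (F k)) → (∀ k → 1 ≤ k → k ≤ p-1 → Integral (w k)) →
    (∀ k → k ≤ p-1 → F (p-1 ∸ k) ≈ F k [mod-p^ 1 ]) →
    (∀ k → 1 ≤ k → k ≤ p-1 → w (p ∸ k) ≈ - w k [mod-p^ 1 ]) →
    (∀ k → 1 ≤ k → F k * w k - F (k ∸ 1) * w k ≡ invPow k 4) →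
    (sumTo p-1 (λ k → F (k ∸ 1) * w k) ≈ 0ℚ [mod-p^ 1 ]) × (sumTo p-1 (λ k → F k * w k) ≈ 0ℚ [mod-p^ 1 ])
  antisymmetric-sums≈0 F w F∈ w∈ F-reflect w-reflect step = ∣ℚ⇒≈0 p∣X , ∣ℚ⇒≈0 p∣Y
    where
    X = sumTo p-1 (λ k → F (k ∸ 1) * w k)
    Y = sumTo p-1 (λ k → F k * w k)
    X≈-Y : X ≈ - Y [mod-p^ 1 ]
    X≈-Y = begin
      X   ≡⟨ trans (sumTo-reflect _) (sumTo-cong p-1 _ _ (λ k _ _ → cong (λ t → F t * w (p ∸ k)) (p∸k∸1≡p-1∸k k))) ⟩
      sumTo p-1 (λ k → F (p-1 ∸ k) * w (p ∸ k))       ≈⟨ ≈-sumTo p-1 _ _ (λ k 1≤k k≤p-1 →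
                                                            ≈-* (F∈ (p-1 ∸ k) (ℕP.m∸n≤m p-1 k)) (integral-neg (w∈ k 1≤k k≤p-1))
                                                                (F-reflect k k≤p-1) (w-reflect k 1≤k k≤p-1)) ⟩
      sumTo p-1 (λ k → F k * - w k)                   ≡⟨ sumTo-cong p-1 _ _ (λ k _ _ → sym (ℚP.neg-distribʳ-* (F k) (w k))) ⟩
      sumTo p-1 (λ k → - (F k * w k))                 ≡⟨ sumTo-neg p-1 _ ⟩
      - Y                                             ∎
      where open ≈-Reasoning 1
    p∣Y-X : p^ 1 ∣ℚ (Y - X)
    p∣Y-X = subst (p^ 1 ∣ℚ_) (trans (sumTo-cong p-1 _ _ (λ k 1≤k _ → sym (step k 1≤k))) (sumTo-minus p-1 _ _)) p∣H[p-1,4]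
    p∣X+Y : p^ 1 ∣ℚ (X + Y)
    p∣X+Y = subst (p^ 1 ∣ℚ_) (solve 2 (λ x y → x :- (:- y) := x :+ y) refl X Y) (∣ℚ-difference X≈-Y)
    p∣Y : p^ 1 ∣ℚ Y
    p∣Y = ∣ℚ-half (subst (p^ 1 ∣ℚ_) (solve 2 (λ x y → (y :- x) :+ (x :+ y) := y :+ y) refl X Y) (∣ℚ-+ p∣Y-X p∣X+Y))
    p∣X : p^ 1 ∣ℚ X
    p∣X = subst (p^ 1 ∣ℚ_) (solve 2 (λ x y → y :- (y :- x) := x) refl X Y) (∣ℚ-minus p∣Y p∣Y-X)

  ΣH₁/k³≈0 : (sumTo p-1 (λ k → H₁ (k ∸ 1) * invPow k 3) ≈ 0ℚ [mod-p^ 1 ]) × (sumTo p-1 (λ k → H₁ k * invPow k 3) ≈ 0ℚ [mod-p^ 1 ])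
  ΣH₁/k³≈0 = antisymmetric-sums≈0 H₁ (λ k → invPow k 3) (λ k → H-integral k 1) (λ k → invPow-integral k 3)
    (H-reflection 1 inverse-reflection p∣H[p-1]) invPow-reflection-3 ΔH₁/k³≡1/k⁴

  ΣH₃/k≈0 : (sumTo p-1 (λ k → H (k ∸ 1) 3 * invPow k 1) ≈ 0ℚ [mod-p^ 1 ]) × (sumTo p-1 (λ k → H k 3 * invPow k 1) ≈ 0ℚ [mod-p^ 1 ])
  ΣH₃/k≈0 = antisymmetric-sums≈0 (λ k → H k 3) (λ k → invPow k 1) (λ k → H-integral k 3) (λ k → invPow-integral k 1)
    (H-reflection 3 invPow-reflection-3 (∣ℚ-weaken p²∣H[p-1,3])) inverse-reflection ΔH₃/k≡1/k⁴

  ΣH₁/k²≈ΣH₁²/k : sumTo p-1 (λ k → H₁ k * invPow k 2) ≈ sumTo p-1 (λ k → (H₁ k ^ℚ 2) * invPow k 1) [mod-p^ 2 ]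
  ΣH₁/k²≈ΣH₁²/k = mod-p^ (∣ℚ-cancel 3 (p∤ 3) (subst (p^ 2 ∣ℚ_) rearrange
    (∣ℚ-minus p²∣H[p-1,3] (∣ℚ-minus p²∣H[p-1]³ (∣ℚ-0 2)))))
    where
    S = sumTo p-1 (λ k → H₁ k * invPow k 2)
    T = sumTo p-1 (λ k → (H₁ k ^ℚ 2) * invPow k 1)
    p²∣H[p-1]³ : p^ 2 ∣ℚ H₁ p-1 ^ℚ 3
    p²∣H[p-1]³ = ∣ℚ-* p∣H[p-1] (∣ℚ-*ʳ p∣H[p-1] (integral-^ 1 (H-integral p-1 1 ℕP.≤-refl)))
    telescoped : H₁ p-1 ^ℚ 3 - H₁ 0 ^ℚ 3 ≡ fromℕ 3 * T - fromℕ 3 * S + H p-1 3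
    telescoped = trans (sym (sumTo-telescope p-1 (λ k → H₁ k ^ℚ 3)))
      (trans (sumTo-cong p-1 _ _ (λ k 1≤k _ → ΔH₁³ k 1≤k)) (sumTo-combination p-1 (fromℕ 3) (fromℕ 3) _ _ _))
    rearrange : H p-1 3 - (H₁ p-1 ^ℚ 3 - H₁ 0 ^ℚ 3) ≡ fromℕ 3 * (S - T)
    rearrange = trans (cong (λ t → H p-1 3 - t) telescoped)
      (solve 4 (λ c t s h → h :- (c :* t :- c :* s :+ h) := c :* (s :- t)) refl (fromℕ 3) T S (H p-1 3))

  ΣH₁³/k≈3/2ΣH₁²/k² : sumTo p-1 (λ k → (H₁ k ^ℚ 3) * invPow k 1) ≈ (+ 3 / 2) * sumTo p-1 (λ k → (H₁ k ^ℚ 2) * invPow k 2) [mod-p^ 1 ]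
  ΣH₁³/k≈3/2ΣH₁²/k² = mod-p^ (∣ℚ-cancel 4 (p∤ 4) (subst (p^ 1 ∣ℚ_) rearrange
    (∣ℚ-minus (∣ℚ-minus p∣H[p-1]⁴ (∣ℚ-0 1)) (∣ℚ-minus (∣ℚ-*ˡ (integral-fromℤ (+ 4)) p∣C) p∣H[p-1,4]))))
    where
    A = sumTo p-1 (λ k → (H₁ k ^ℚ 3) * invPow k 1)
    B = sumTo p-1 (λ k → (H₁ k ^ℚ 2) * invPow k 2)
    C = sumTo p-1 (λ k → H₁ k * invPow k 3)
    p∣C : p^ 1 ∣ℚ C
    p∣C = ≈0⇒∣ℚ (proj₂ ΣH₁/k³≈0)
    p∣H[p-1]⁴ : p^ 1 ∣ℚ H₁ p-1 ^ℚ 4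
    p∣H[p-1]⁴ = ∣ℚ-*ʳ p∣H[p-1] (integral-^ 3 (H-integral p-1 1 ℕP.≤-refl))
    telescoped : H₁ p-1 ^ℚ 4 - H₁ 0 ^ℚ 4 ≡ fromℕ 4 * A - fromℕ 6 * B + (fromℕ 4 * C - H p-1 4)
    telescoped = trans (sym (sumTo-telescope p-1 (λ k → H₁ k ^ℚ 4)))
      (trans (sumTo-cong p-1 _ _ (λ k 1≤k _ → ΔH₁⁴ k 1≤k))
      (trans (sumTo-combination p-1 (fromℕ 4) (fromℕ 6) _ _ _)
             (cong (λ t → fromℕ 4 * A - fromℕ 6 * B + t)
                   (trans (sumTo-minus p-1 _ _) (cong (_- H p-1 4) (sumTo-*ˡ p-1 (fromℕ 4) _))))))
    rearrange : (H₁ p-1 ^ℚ 4 - H₁ 0 ^ℚ 4) - (fromℕ 4 * C - H p-1 4) ≡ fromℕ 4 * (A - (+ 3 / 2) * B)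
    rearrange = trans (cong (λ t → t - (fromℕ 4 * C - H p-1 4)) telescoped)
      (solve 3 (λ a b e → (con (fromℕ 4) :* a :- con (fromℕ 6) :* b :+ e) :- e := con (fromℕ 4) :* (a :- con (+ 3 / 2) :* b))
             refl A B (fromℕ 4 * C - H p-1 4))

lemma2p3 : (p : ℕ) → Prime p → p ≥ 7 →
    ((sumTo (p ∸ 1) (λ k → H₁ (k ∸ 1) * invPow k 3) ≡ 0ℚ mod p ^ 1)
      × (sumTo (p ∸ 1) (λ k → H₁ k * invPow k 3) ≡ 0ℚ mod p ^ 1))
    × (sumTo (p ∸ 1) (λ k → (H₁ k ^ℚ 3) * invPow k 1)
        ≡ (+ 3 / 2) * sumTo (p ∸ 1) (λ k → (H₁ k ^ℚ 2) * invPow k 2) mod p ^ 1)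
    × ((sumTo (p ∸ 1) (λ k → H (k ∸ 1) 3 * invPow k 1) ≡ 0ℚ mod p ^ 1)
      × (sumTo (p ∸ 1) (λ k → H k 3 * invPow k 1) ≡ 0ℚ mod p ^ 1))
    × (sumTo (p ∸ 1) (λ k → H₁ k * invPow k 2)
        ≡ sumTo (p ∸ 1) (λ k → (H₁ k ^ℚ 2) * invPow k 1) mod p ^ 2)
lemma2p3 p p-prime p≥7 =
  (≈⇒≡mod (proj₁ ΣH₁/k³≈0) , ≈⇒≡mod (proj₂ ΣH₁/k³≈0)) ,
  ≈⇒≡mod ΣH₁³/k≈3/2ΣH₁²/k² ,
  (≈⇒≡mod (proj₁ ΣH₃/k≈0) , ≈⇒≡mod (proj₂ ΣH₃/k≈0)) ,
  ≈⇒≡mod ΣH₁/k²≈ΣH₁²/k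
  where
  open Localisation p p-prime using (≈⇒≡mod)
  open Harmonic p p-prime p≥7
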